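{- Let $k\ge 3$ and $G=G_{n,k}$. If $u$ and $v$ are two nonadjacent vertices of $G$, then $P_{G+uv}(k)<(k-1)!\left((k-1)^{n-k+1}+(-1)^{n-k}\right)$.
   Context: All graphs are finite and simple; $P_G(k)$ is the number of proper $k$-colorings of $G$. $G_{n,k}$ is the graph on $n$ vertices obtained from a $k$-clique by adding an ear (path) with $n-k$ internal vertices, each of degree $2$, attached to two distinct vertices of the clique. $G+uv$ denotes $G$ with the edge $uv$ added. -}

module Defs where

open import Data.Bool using (Bool; true; false; _∧_; _∨_; not)
open import Data.Nat using (ℕ; zero; suc; _<ᵇ_; _≡ᵇ_; _≤ᵇ_; _∸_; _+_)
open import Data.Fin using (Fin; toℕ; _≟_)
open import Data.Fin.Properties using (all?)
open import Data.List using (List; []; _∷_; map; concatMap; filter; length)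
open import Data.List using (allFin) renaming ([_] to [_]ₗ)
open import Data.Vec.Functional as VF using ()
open import Relation.Binary.PropositionalEquality using (_≡_; _≢_)
open import Relation.Nullary using (Dec; ¬?)
open import Relation.Nullary.Decidable using (_→-dec_)
open import Data.Bool.Properties using () renaming (_≟_ to _≟ᵇ_)

-- A graph on vertex set Fin n, given by a Bool-valued adjacency function.
-- (All graphs used below are symmetric and loopless by construction.)
Graph : ℕ → Set
Graph n = Fin n → Fin n → Bool

Adj : ∀ {n} → Graph n → Fin n → Fin n → Set
Adj G x y = G x y ≡ true

Proper : ∀ {n} (G : Graph n) (q : ℕ) → (Fin n → Fin q) → Set
Proper G q c = ∀ x y → Adj G x y → c x ≢ c y

proper? : ∀ {n} (G : Graph n) (q : ℕ) (c : Fin n → Fin q) → Dec (Proper G q c)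
proper? G q c = all? λ x → all? λ y → (G x y ≟ᵇ true) →-dec ¬? (c x ≟ c y)

allColourings : (n q : ℕ) → List (Fin n → Fin q)
allColourings zero    q = [ (λ ()) ]ₗ
allColourings (suc n) q =
  concatMap (λ c → map (λ f → c VF.∷ f) (allColourings n q)) (allFin q)

-- chromatic polynomial evaluated at q: number of proper q-colourings
P : ∀ {n} → Graph n → ℕ → ℕ
P {n} G q = length (filter (proper? G q) (allColourings n q))

eqᵇ : ∀ {n} → Fin n → Fin n → Bool
eqᵇ x y = toℕ x ≡ᵇ toℕ y

_+E_─_ : ∀ {n} → Graph n → Fin n → Fin n → Graph n
(G +E u ─ v) x y =
  G x y ∨ (eqᵇ x u ∧ eqᵇ y v) ∨ (eqᵇ x v ∧ eqᵇ y u)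

-- G_{n,k}: vertices 0..k-1 form a k-clique; vertices k, k+1, ..., n-1 are the
-- internal vertices of an ear (path)  a - k - (k+1) - ... - (n-1) - b,
-- where a ≠ b are clique vertices.
earBase : (n k a b : ℕ) → ℕ → ℕ → Bool
earBase n k a b i j =
     ((i <ᵇ j) ∧ (j <ᵇ k))
  ∨ ((k ≤ᵇ i) ∧ (j ≡ᵇ suc i) ∧ (j <ᵇ n))
  ∨ ((i ≡ᵇ a) ∧ (j ≡ᵇ k))
  ∨ ((i ≡ᵇ (n ∸ 1)) ∧ (j ≡ᵇ b))

Gnk : (n k a b : ℕ) → Graph n
Gnk n k a b x y = earBase n k a b (toℕ x) (toℕ y) ∨ earBase n k a b (toℕ y) (toℕ x)

module Submission where

-- Write m = n − k.  Colour the vertices 0, 1, …, n−1 in order.  The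
--    i-th clique vertex has to avoid the i colours already on the clique; each ear vertex
--    has to avoid the colour of its predecessor, and the last one also that of b.  Keeping
--    track of whether the current ear colour equals the colour of b gives the transfer
--    weights `same` / `diff`, and P(G, q) ≤ q (q−1) ⋯ (q−k+1) · diff q m.
--  * Closed form (diff-closed).  For q = k ≥ 2, k · diff k m = (k−1)^{m+1} + (−1)^m, so
--    the bound above equals the right-hand side of the lemma.
--  * Strictness (P-+E-<, identifying-colouring).  Some proper k-colouring of G colours
--    u and v alike (clique coloured by the identity, ear coloured greedily from three
--    colours with the ear positions of u and v pinned); it is lost in G + uv.

open import Defs
open import Data.Bool using (false)
open import Data.Nat using (ℕ; _≤_; _<_; _∸_; _+_; _!)
open import Data.Fin using (Fin; toℕ)
open import Data.Integer using (ℤ; +_; -1ℤ) renaming (_<_ to _<ℤ_; _+_ to _+ℤ_; _*_ to _*ℤ_; _^_ to _^ℤ_)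
open import Relation.Binary.PropositionalEquality using (_≢_; _≡_)

open import Data.Bool using (Bool; true; T; if_then_else_; _∨_; _∧_)
open import Data.Bool.Properties using (T-≡; T-∨; T-∧)
open import Data.Nat using (zero; suc; pred; _*_; _^_; z≤n; s≤s; _<ᵇ_; _≤ᵇ_; _≡ᵇ_; _<?_)
  renaming (_≟_ to _≟ℕ_)
open import Data.Nat.Properties
  using ( +-comm; +-assoc; +-suc; +-identityʳ; +-cancelʳ-≡; +-mono-≤; *-assoc; *-comm
        ; *-distribˡ-+; *-distribʳ-∸; m+n∸n≡m; m+n∸m≡n; m+[n∸m]≡n; +-∸-assoc; n∸n≡0
        ; ∸-monoˡ-≤; ∸-monoˡ-<; ∸-monoʳ-<; ∸-cancelʳ-≡; pred[m∸n]≡m∸[1+n]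
        ; ≤-refl; ≤-trans; ≤-reflexive; <-trans; <-≤-trans; <-irrefl; <-asym; <-cmp; <⇒≤; <⇒≢; <⇒≱
        ; ≮⇒≥; n<1+n; m<m+n; m≤n⇒m≤1+n; m<n⇒m<1+n; m<1+n⇒m<n∨m≡n; suc-injective; 1+n≢n; 1+n≰n
        ; <⇒<ᵇ; <ᵇ⇒<; ≤⇒≤ᵇ; ≤ᵇ⇒≤; ≡⇒≡ᵇ; ≡ᵇ⇒≡
        ; +-0-commutativeMonoid; +-commutativeSemigroup; module ≤-Reasoning )
import Data.Nat.Tactic.RingSolver as ℕ-Ring
open import Data.Fin using (zero; suc; fromℕ<)
open import Data.Fin.Properties using (_≟_; toℕ-fromℕ<; toℕ-injective; toℕ<n)
open import Data.Integer using (+<+) renaming (_-_ to _-ℤ_)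
open import Data.Integer.Properties using (pos-+; pos-*)
import Data.Integer.Tactic.RingSolver as ℤ-Ring
open import Data.List using (List; []; _∷_; _++_; length; filter; map; concatMap; tabulate; downFrom)
open import Data.List.Properties
  using (length-++; length-map; length-downFrom; filter-++; filter-accept; filter-reject; filter-none
        ; length-filter; map-cong-local)
open import Data.List.Membership.Propositional.Properties using (∈-map⁻; ∈-map⁺; ∈-downFrom⁻; ∈-downFrom⁺)
open import Data.List.Relation.Unary.Any using (Any; here; there)
open import Data.List.Relation.Unary.Any.Properties using (concatMap⁺; tabulate⁺; map⁺)
open import Data.List.Relation.Unary.All.Properties using (All¬⇒¬Any; ¬Any⇒All¬)
open import Data.List.Relation.Unary.Unique.Propositional using (Unique; []; _∷_)
open import Data.List.Relation.Binary.Sublist.Propositional using (⊆-refl)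
open import Data.List.Relation.Binary.Sublist.Propositional.Properties using (filter⁺; length-mono-≤)
open import Data.Vec.Functional using () renaming (_∷_ to _∷ᶠ_)
open import Data.Product using (_×_; _,_; Σ-syntax)
open import Data.Sum using (_⊎_; inj₁; inj₂)
open import Data.Empty using (⊥-elim)
open import Function using (_∘_; id; Equivalence)
open import Relation.Nullary using (¬_; yes; no; does)
open import Relation.Nullary.Decidable using (_⊎-dec_)
open import Relation.Unary using (Decidable)
open import Relation.Binary.Definitions using (tri<; tri≈; tri>)
open import Relation.Binary.PropositionalEquality
  using (refl; sym; trans; cong; cong₂; subst; subst₂; _≗_; module ≡-Reasoning)
open import Algebra.Properties.CommutativeMonoid.Sum +-0-commutativeMonoid using (sum; sum-cong-≗)
open import Algebra.Properties.CommutativeSemigroup +-commutativeSemigroup using (x∙yz≈y∙xz; x∙yz≈xz∙y)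
import Data.List.Relation.Unary.All as All
import Data.List.Relation.Unary.Any as Any
import Data.Sum as Sum

open Equivalence using (to; from)

sum-mono : ∀ {q} {f g : Fin q → ℕ} → (∀ c → f c ≤ g c) → sum f ≤ sum g
sum-mono {zero}  f≤g = z≤n
sum-mono {suc q} f≤g = +-mono-≤ (f≤g zero) (sum-mono (f≤g ∘ suc))

sum-const : ∀ q F → sum {q} (λ _ → F) ≡ q * F
sum-const zero    F = refl
sum-const (suc q) F = cong (_+_ F) (sum-const q F)

sum-without : ∀ {q} (x : Fin q) (g : Fin q → ℕ) →
  sum (λ c → if does (c ≟ x) then 0 else g c) + g x ≡ sum g
sum-without zero    g = +-comm (sum (g ∘ suc)) (g zero)
sum-without (suc x) g =
  trans (+-assoc (g zero) _ (g (suc x))) (cong (_+_ (g zero)) (sum-without x (g ∘ suc)))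

sum-point : ∀ {q} (x : Fin q) A B →
  sum (λ c → if does (c ≟ x) then A else B) ≡ A + (q ∸ 1) * B
sum-point {suc q}       zero    A B = cong (_+_ A) (sum-const q B)
sum-point {suc (suc q)} (suc x) A B =
  trans (cong (_+_ B) (sum-point x A B)) (x∙yz≈y∙xz B A (q * B))

module _ {q : ℕ} where
  open import Data.List.Membership.DecPropositional (_≟_ {q}) using (_∈?_)

  sum-outside-+ : ∀ (U : List (Fin q)) F → Unique U →
    sum (λ c → if does (c ∈? U) then 0 else F) + length U * F ≡ q * F
  sum-outside-+ []      F []            = trans (+-identityʳ _) (sum-const q F)
  sum-outside-+ (u ∷ U) F (u∉U ∷ uniq) = begin
    sum (λ c → if does (c ∈? (u ∷ U)) then 0 else F) + (F + length U * F)
      ≡⟨ cong₂ (λ S G → S + (G + length U * F)) (sum-cong-≗ split) (sym g-u) ⟩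
    sum (λ c → if does (c ≟ u) then 0 else g c) + (g u + length U * F)
      ≡⟨ +-assoc (sum (λ c → if does (c ≟ u) then 0 else g c)) (g u) (length U * F) ⟨
    sum (λ c → if does (c ≟ u) then 0 else g c) + g u + length U * F
      ≡⟨ cong (_+ length U * F) (sum-without u g) ⟩
    sum g + length U * F
      ≡⟨ sum-outside-+ U F uniq ⟩
    q * F ∎
    where
    open ≡-Reasoning
    g : Fin q → ℕ
    g c = if does (c ∈? U) then 0 else F
    split : ∀ c → (if does (c ∈? (u ∷ U)) then 0 else F) ≡ (if does (c ≟ u) then 0 else g c)
    split c with c ≟ u
    ... | yes _ = refl
    ... | no  _ = refl
    g-u : g u ≡ F
    g-u with u ∈? U
    ... | yes u∈U = ⊥-elim (All¬⇒¬Any u∉U u∈U)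
    ... | no  _ = refl

  sum-outside : ∀ (U : List (Fin q)) F → Unique U →
    sum (λ c → if does (c ∈? U) then 0 else F) ≡ (q ∸ length U) * F
  sum-outside U F uniq = begin
    S                                  ≡⟨ m+n∸n≡m S (length U * F) ⟨
    S + length U * F ∸ length U * F    ≡⟨ cong (_∸ length U * F) (sum-outside-+ U F uniq) ⟩
    q * F ∸ length U * F               ≡⟨ *-distribʳ-∸ F q (length U) ⟨
    (q ∸ length U) * F                 ∎
    where
    open ≡-Reasoning
    S : ℕ
    S = sum (λ c → if does (c ∈? U) then 0 else F)

-- the sum behind one step along the ear: the next colour c avoids x, and the
-- weight of c depends on whether c is the colour y of b
sum-avoiding : ∀ {q} (x y : Fin q) A B →
  sum (λ c → if does (c ≟ x) then 0 else (if does (c ≟ y) then A else B))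
    ≡ (if does (x ≟ y) then (q ∸ 1) * B else A + (q ∸ 2) * B)
sum-avoiding {q} x y A B with x ≟ y
... | yes refl = trans (sum-cong-≗ collapse) (sum-point x 0 B)
  where
  collapse : ∀ c → (if does (c ≟ x) then 0 else (if does (c ≟ x) then A else B))
                 ≡ (if does (c ≟ x) then 0 else B)
  collapse c with c ≟ x
  ... | yes _ = refl
  ... | no  _ = refl
... | no x≢y = +-cancelʳ-≡ B _ _ (begin
  S + B                  ≡⟨ cong (_+_ S) g-x ⟨
  S + g x                ≡⟨ sum-without x g ⟩
  sum g                  ≡⟨ sum-point y A B ⟩
  A + (q ∸ 1) * B        ≡⟨ two-colours x≢y ⟩
  A + (q ∸ 2) * B + B    ∎)
  where
  open ≡-Reasoning
  g : Fin q → ℕ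
  g c = if does (c ≟ y) then A else B
  S : ℕ
  S = sum (λ c → if does (c ≟ x) then 0 else g c)
  g-x : g x ≡ B
  g-x with x ≟ y
  ... | yes x≡y = ⊥-elim (x≢y x≡y)
  ... | no  _   = refl
  two-colours : ∀ {q} {x y : Fin q} → x ≢ y → A + (q ∸ 1) * B ≡ A + (q ∸ 2) * B + B
  two-colours {suc zero}    {zero} {zero} x≢y = ⊥-elim (x≢y refl)
  two-colours {suc (suc q)} _ = x∙yz≈xz∙y A B (q * B)

module _ {A : Set} {Q R : A → Set} (Q? : Decidable Q) (R? : Decidable R)
         (Q⇒R : ∀ {x} → Q x → R x) where

  filter-length-mono : ∀ xs → length (filter Q? xs) ≤ length (filter R? xs)
  filter-length-mono xs = length-mono-≤ (filter⁺ Q? R? (λ { refl → Q⇒R }) (⊆-refl {x = xs}))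

  filter-length-strict : ∀ {xs} → Any (λ x → R x × ¬ Q x) xs →
    length (filter Q? xs) < length (filter R? xs)
  filter-length-strict {x ∷ xs} (here (r , ¬q))
    rewrite filter-reject Q? {xs = xs} ¬q | filter-accept R? {xs = xs} r = s≤s (filter-length-mono xs)
  filter-length-strict {x ∷ xs} (there p) with Q? x | R? x
  ... | yes q | yes r = s≤s (filter-length-strict p)
  ... | yes q | no ¬r = ⊥-elim (¬r (Q⇒R q))
  ... | no ¬q | yes r = m<n⇒m<1+n (filter-length-strict p)
  ... | no ¬q | no ¬r = filter-length-strict p

filter-length-map : ∀ {A B : Set} {Q : B → Set} (Q? : Decidable Q) (g : A → B) xs →
  length (filter Q? (map g xs)) ≡ length (filter (Q? ∘ g) xs)
filter-length-map Q? g []       = refl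
filter-length-map Q? g (x ∷ xs) with does (Q? (g x))
... | true  = cong suc (filter-length-map Q? g xs)
... | false = filter-length-map Q? g xs

filter-length-concatMap : ∀ {A B : Set} {Q : A → Set} (Q? : Decidable Q) {q}
  (h : Fin q → B) (F : B → List A) →
  length (filter Q? (concatMap F (tabulate h))) ≡ sum (λ c → length (filter Q? (F (h c))))
filter-length-concatMap Q? {zero}  h F = refl
filter-length-concatMap Q? {suc q} h F = begin
  length (filter Q? (F (h zero) ++ concatMap F (tabulate (h ∘ suc))))
    ≡⟨ cong length (filter-++ Q? (F (h zero)) _) ⟩
  length (filter Q? (F (h zero)) ++ filter Q? (concatMap F (tabulate (h ∘ suc))))
    ≡⟨ length-++ (filter Q? (F (h zero))) ⟩
  length (filter Q? (F (h zero))) + length (filter Q? (concatMap F (tabulate (h ∘ suc))))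
    ≡⟨ cong (_+_ (length (filter Q? (F (h zero))))) (filter-length-concatMap Q? (h ∘ suc) F) ⟩
  sum (λ c → length (filter Q? (F (h c)))) ∎
  where open ≡-Reasoning

count : ∀ {j q} {Q : (Fin j → Fin q) → Set} → Decidable Q → ℕ
count {j} {q} Q? = length (filter Q? (allColourings j q))

count-cons : ∀ {j q} {Q : (Fin (suc j) → Fin q) → Set} (Q? : Decidable Q) →
  count Q? ≡ sum (λ c → count (λ f → Q? (c ∷ᶠ f)))
count-cons {j} {q} Q? =
  trans (filter-length-concatMap Q? id (λ c → map (c ∷ᶠ_) (allColourings j q)))
        (sum-cong-≗ (λ c → filter-length-map Q? (c ∷ᶠ_) (allColourings j q)))

count-none : ∀ {j q} {Q : (Fin j → Fin q) → Set} (Q? : Decidable Q) → (∀ f → ¬ Q f) → count Q? ≡ 0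
count-none {j} {q} Q? none = cong length (filter-none Q? (All.universal none (allColourings j q)))

count-empty : ∀ {q} {Q : (Fin 0 → Fin q) → Set} (Q? : Decidable Q) → count Q? ≤ 1
count-empty {q} Q? = length-filter Q? (allColourings 0 q)

allColourings-complete : ∀ j {q} (c : Fin j → Fin q) → Any (_≗ c) (allColourings j q)
allColourings-complete zero    c = here (λ ())
allColourings-complete (suc j) c =
  concatMap⁺ (λ d → map (d ∷ᶠ_) (allColourings j _))
    (tabulate⁺ (c zero) (map⁺ (Any.map prepend (allColourings-complete j (c ∘ suc)))))
  where
  prepend : ∀ {f} → f ≗ c ∘ suc → (c zero ∷ᶠ f) ≗ c
  prepend f≗c zero    = refl
  prepend f≗c (suc x) = f≗c x

Proper-≗ : ∀ {n q} (G : Graph n) {c c′ : Fin n → Fin q} → c ≗ c′ → Proper G q c → Proper G q c′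
Proper-≗ G c≗c′ proper x y adj equal = proper x y adj (trans (c≗c′ x) (trans equal (sym (c≗c′ y))))

-- adding the edge uv loses every proper colouring that colours u and v alike,
-- so if there is one, the number of proper colourings drops
P-+E-< : ∀ {n q} (G : Graph n) (u v : Fin n) (c : Fin n → Fin q) → Proper G q c → c u ≡ c v →
  P (G +E u ─ v) q < P G q
P-+E-< {n} {q} G u v c proper cu≡cv =
  filter-length-strict (proper? (G +E u ─ v) q) (proper? G q) fewer-edges
    (Any.map (λ f≗c → Proper-≗ G (sym ∘ f≗c) proper , lost f≗c) (allColourings-complete n c))
  where
  fewer-edges : ∀ {f} → Proper (G +E u ─ v) q f → Proper G q f
  fewer-edges proper′ x y adj = proper′ x y (cong (_∨ _) adj)
  uv-edge : Adj (G +E u ─ v) u v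
  uv-edge = to T-≡ (from (T-∨ {G u v}) (inj₂ (from (T-∨ {eqᵇ u u ∧ eqᵇ v v})
              (inj₁ (from T-∧ (≡⇒≡ᵇ (toℕ u) (toℕ u) refl , ≡⇒≡ᵇ (toℕ v) (toℕ v) refl))))))
  lost : ∀ {f} → f ≗ c → ¬ Proper (G +E u ─ v) q f
  lost f≗c proper′ = proper′ u v uv-edge (trans (f≗c u) (trans cu≡cv (sym (f≗c v))))

-- Transfer weights for the ear with q colours: the number of ways to colour j more
-- ear vertices (the last of which must avoid the colour of b) when the colour of the
-- previous ear vertex equals (same) or differs from (diff) the colour of b.
same diff : ℕ → ℕ → ℕ
same q zero    = 0
same q (suc j) = (q ∸ 1) * diff q j
diff q zero    = 1
diff q (suc j) = same q j + (q ∸ 2) * diff q j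

module _ (t′ : ℕ) where
  private
    t q : ℕ
    t = suc t′
    q = suc t

  -- same + t · diff counts all t^{m+1} ways to colour m + 1 path vertices after a fixed colour
  walks : ∀ m → same q m + t * diff q m ≡ t ^ suc m
  walks zero    = refl
  walks (suc m) = trans (expand t′ (same q m) (diff q m)) (cong (t *_) (walks m))
    where
    expand : ∀ t′ S D → suc t′ * D + suc t′ * (S + t′ * D) ≡ suc t′ * (S + suc t′ * D)
    expand = ℕ-Ring.solve-∀

  diff-step : ∀ m → diff q (suc m) + diff q m ≡ t ^ suc m
  diff-step m = trans (regroup t′ (same q m) (diff q m)) (walks m)
    where
    regroup : ∀ t′ S D → S + t′ * D + D ≡ S + suc t′ * D
    regroup = ℕ-Ring.solve-∀

  diff-closed : ∀ m → + (q * diff q m) ≡ + (t ^ suc m) +ℤ -1ℤ ^ℤ m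
  diff-closed zero    = trans (cong +_ (+-comm 1 (t * 1))) (pos-+ (t * 1) 1)
  diff-closed (suc m) = begin
    X                            ≡⟨ cancel X Y ⟩
    (X +ℤ Y) -ℤ Y                ≡⟨ cong₂ _-ℤ_ sum-XY (diff-closed m) ⟩
    (A +ℤ B) -ℤ (A +ℤ E)         ≡⟨ cancel′ A B E ⟩
    B +ℤ -1ℤ *ℤ E                ∎
    where
    open ≡-Reasoning
    X Y A B E : ℤ
    X = + (q * diff q (suc m))
    Y = + (q * diff q m)
    A = + (t ^ suc m)
    B = + (t ^ suc (suc m))
    E = -1ℤ ^ℤ m
    cancel : ∀ X Y → X ≡ (X +ℤ Y) -ℤ Y
    cancel = ℤ-Ring.solve-∀
    cancel′ : ∀ A B E → (A +ℤ B) -ℤ (A +ℤ E) ≡ B +ℤ -1ℤ *ℤ E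
    cancel′ = ℤ-Ring.solve-∀
    sum-XY : X +ℤ Y ≡ A +ℤ B
    sum-XY = begin
      X +ℤ Y                        ≡⟨ pos-+ (q * diff q (suc m)) _ ⟨
      + (q * diff q (suc m) + q * diff q m) ≡⟨ cong +_ (*-distribˡ-+ q (diff q (suc m)) (diff q m)) ⟨
      + (q * (diff q (suc m) + diff q m)) ≡⟨ cong (λ x → + (q * x)) (diff-step m) ⟩
      + (q * t ^ suc m)             ≡⟨ pos-+ (t ^ suc m) _ ⟩
      A +ℤ B                        ∎

falling : ℕ → ℕ → ℕ
falling r zero    = 1
falling r (suc s) = r * falling (pred r) s

falling-! : ∀ r → falling r r ≡ r !
falling-! zero    = refl
falling-! (suc r) = cong (suc r *_) (falling-! r)

data EarEdge (n k a b : ℕ) : ℕ → ℕ → Set where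
  clique  : ∀ {i j} → i < j → j < k → EarEdge n k a b i j
  path    : ∀ {i} → k ≤ i → suc i < n → EarEdge n k a b i (suc i)
  attachA : EarEdge n k a b a k
  attachB : EarEdge n k a b (n ∸ 1) b

module _ {n k a b : ℕ} where

  cliqueᵇ pathᵇ attachAᵇ attachBᵇ : ℕ → ℕ → Bool
  cliqueᵇ  i j = (i <ᵇ j) ∧ (j <ᵇ k)
  pathᵇ    i j = (k ≤ᵇ i) ∧ (j ≡ᵇ suc i) ∧ (j <ᵇ n)
  attachAᵇ i j = (i ≡ᵇ a) ∧ (j ≡ᵇ k)
  attachBᵇ i j = (i ≡ᵇ (n ∸ 1)) ∧ (j ≡ᵇ b)

  earBase-sound : ∀ {i j} → EarEdge n k a b i j → T (earBase n k a b i j)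
  earBase-sound {i} {j} e = from (T-∨ {cliqueᵇ i j}) (Sum.map₂ (from (T-∨ {pathᵇ i j})) (sound e))
    where
    sound : EarEdge n k a b i j → T (cliqueᵇ i j) ⊎ T (pathᵇ i j) ⊎ T (attachAᵇ i j ∨ attachBᵇ i j)
    sound (clique i<j j<k) = inj₁ (from T-∧ (<⇒<ᵇ i<j , <⇒<ᵇ j<k))
    sound (path k≤i i+1<n) =
      inj₂ (inj₁ (from T-∧ (≤⇒≤ᵇ k≤i , from T-∧ (≡⇒≡ᵇ (suc i) (suc i) refl , <⇒<ᵇ i+1<n))))
    sound attachA =
      inj₂ (inj₂ (from (T-∨ {attachAᵇ i j}) (inj₁ (from T-∧ (≡⇒≡ᵇ a a refl , ≡⇒≡ᵇ k k refl)))))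
    sound attachB =
      inj₂ (inj₂ (from (T-∨ {attachAᵇ i j})
        (inj₂ (from T-∧ (≡⇒≡ᵇ (n ∸ 1) (n ∸ 1) refl , ≡⇒≡ᵇ b b refl)))))

  earBase-complete : ∀ i j → T (earBase n k a b i j) → EarEdge n k a b i j
  earBase-complete i j e with to (T-∨ {cliqueᵇ i j}) e
  ... | inj₁ e₁ with to (T-∧ {i <ᵇ j}) e₁
  ...   | i<j , j<k = clique (<ᵇ⇒< i j i<j) (<ᵇ⇒< j k j<k)
  earBase-complete i j e | inj₂ e₂ with to (T-∨ {pathᵇ i j}) e₂
  ... | inj₁ e₃ with to (T-∧ {k ≤ᵇ i}) e₃
  ...   | k≤i , e₄ with to (T-∧ {j ≡ᵇ suc i}) e₄
  ...     | j≡i+1 , j<n with ≡ᵇ⇒≡ j (suc i) j≡i+1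
  ...       | refl = path (≤ᵇ⇒≤ k i k≤i) (<ᵇ⇒< j n j<n)
  earBase-complete i j e | inj₂ e₂ | inj₂ e₅ with to (T-∨ {attachAᵇ i j}) e₅
  ... | inj₁ e₆ with to (T-∧ {i ≡ᵇ a}) e₆
  ...   | i≡a , j≡k with ≡ᵇ⇒≡ i a i≡a | ≡ᵇ⇒≡ j k j≡k
  ...     | refl | refl = attachA
  earBase-complete i j e | inj₂ e₂ | inj₂ e₅ | inj₂ e₇ with to (T-∧ {i ≡ᵇ (n ∸ 1)}) e₇
  ... | i≡n-1 , j≡b with ≡ᵇ⇒≡ i (n ∸ 1) i≡n-1 | ≡ᵇ⇒≡ j b j≡b
  ...   | refl | refl = attachB

  edge⇒adj : ∀ {x y : Fin n} → EarEdge n k a b (toℕ x) (toℕ y) ⊎ EarEdge n k a b (toℕ y) (toℕ x) →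
    Adj (Gnk n k a b) x y
  edge⇒adj {x} {y} e =
    to T-≡ (from (T-∨ {earBase n k a b (toℕ x) (toℕ y)}) (Sum.map earBase-sound earBase-sound e))

  adj⇒edge : ∀ {x y : Fin n} → Adj (Gnk n k a b) x y →
    EarEdge n k a b (toℕ x) (toℕ y) ⊎ EarEdge n k a b (toℕ y) (toℕ x)
  adj⇒edge {x} {y} adj =
    Sum.map (earBase-complete _ _) (earBase-complete _ _)
      (to (T-∨ {earBase n k a b (toℕ x) (toℕ y)}) (from T-≡ adj))

proper-from-ℕ : ∀ {n k a b q} (col : ℕ → ℕ) → (∀ v → col v < q) →
  (∀ {i j} → EarEdge n k a b i j → col i ≢ col j) →
  Σ[ c ∈ (Fin n → Fin q) ] Proper (Gnk n k a b) q c × (∀ x → toℕ (c x) ≡ col (toℕ x))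
proper-from-ℕ {n} {k} {a} {b} {q} col bounded separating = c , proper , toℕ-c
  where
  c : Fin n → Fin q
  c x = fromℕ< (bounded (toℕ x))
  toℕ-c : ∀ x → toℕ (c x) ≡ col (toℕ x)
  toℕ-c x = toℕ-fromℕ< (bounded (toℕ x))
  proper : Proper (Gnk n k a b) q c
  proper x y adj equal with adj⇒edge adj
  ... | inj₁ e = separating e (trans (sym (toℕ-c x)) (trans (cong toℕ equal) (toℕ-c y)))
  ... | inj₂ e = separating e (trans (sym (toℕ-c y)) (trans (cong toℕ (sym equal)) (toℕ-c x)))

non-adjacent : ∀ {n k a b} {u v : Fin n} → Gnk n k a b u v ≡ false →
  ¬ (EarEdge n k a b (toℕ u) (toℕ v) ⊎ EarEdge n k a b (toℕ v) (toℕ u))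
non-adjacent nonadj e with trans (sym (edge⇒adj e)) nonadj
... | ()

-- Partial colourings of the vertices 0, 1, 2, … as sequences ℕ → A.
module _ {A : Set} where

  _[_≔_] : (ℕ → A) → ℕ → A → ℕ → A
  (g [ zero  ≔ c ]) zero    = c
  (g [ zero  ≔ c ]) (suc x) = g (suc x)
  (g [ suc i ≔ c ]) zero    = g zero
  (g [ suc i ≔ c ]) (suc x) = ((g ∘ suc) [ i ≔ c ]) x

  set-at : ∀ g i (c : A) → (g [ i ≔ c ]) i ≡ c
  set-at g zero    c = refl
  set-at g (suc i) c = set-at (g ∘ suc) i c

  set-below : ∀ g i (c : A) {x} → x < i → (g [ i ≔ c ]) x ≡ g x
  set-below g (suc i) c {zero}  _         = refl
  set-below g (suc i) c {suc x} (s≤s x<i) = set-below (g ∘ suc) i c x<i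

  -- f written in front of g: f 0, …, f (j−1), g j, g (j+1), …
  prepend : ∀ {j} → (Fin j → A) → (ℕ → A) → ℕ → A
  prepend {zero}  f g x       = g x
  prepend {suc j} f g zero    = f zero
  prepend {suc j} f g (suc x) = prepend (f ∘ suc) (g ∘ suc) x

  prepend-toℕ : ∀ {j} (f : Fin j → A) g x → prepend f g (toℕ x) ≡ f x
  prepend-toℕ f g zero    = refl
  prepend-toℕ f g (suc x) = prepend-toℕ (f ∘ suc) (g ∘ suc) x

  -- the partial colouring g, kept below position i, continued by f from position i on
  splice : ∀ {j} → ℕ → (ℕ → A) → (Fin j → A) → ℕ → A
  splice zero    g f x       = prepend f g x
  splice (suc i) g f zero    = g zero
  splice (suc i) g f (suc x) = splice i (g ∘ suc) f x

  splice-below : ∀ {j} i g (f : Fin j → A) {x} → x < i → splice i g f x ≡ g x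
  splice-below (suc i) g f {zero}  _         = refl
  splice-below (suc i) g f {suc x} (s≤s x<i) = splice-below i (g ∘ suc) f x<i

  splice-cons : ∀ {j} i g c (f : Fin j → A) x → splice i g (c ∷ᶠ f) x ≡ splice (suc i) (g [ i ≔ c ]) f x
  splice-cons zero    g c f zero    = refl
  splice-cons zero    g c f (suc x) = refl
  splice-cons (suc i) g c f zero    = refl
  splice-cons (suc i) g c f (suc x) = splice-cons i (g ∘ suc) c f x

-- Upper bound for the number of proper q-colourings of G_{n,k}.
module EarCount {n k a b : ℕ} (a<k : a < k) (b<k : b < k) (k<n : k < n) (a≢b : a ≢ b) (q : ℕ) where

  open import Data.List.Membership.DecPropositional (_≟_ {q}) using (_∈?_)

  G : Graph n
  G = Gnk n k a b

  E : ℕ → ℕ → Set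
  E = EarEdge n k a b

  edge-bounded : ∀ {i j} → E i j → i < n × j < n
  edge-bounded (clique i<j j<k)  = <-trans (<-trans i<j j<k) k<n , <-trans j<k k<n
  edge-bounded (path _ i+1<n)    = <-trans (n<1+n _) i+1<n , i+1<n
  edge-bounded attachA           = <-trans a<k k<n , k<n
  edge-bounded attachB           = ∸-monoʳ-< (s≤s z≤n) (≤-trans (s≤s z≤n) k<n) , <-trans b<k k<n

  edge-conflict : ∀ {i j} (col : ℕ → Fin q) → E i j → col i ≡ col j → ¬ Proper G q (col ∘ toℕ)
  edge-conflict {i} {j} col e equal proper with edge-bounded e
  ... | i<n , j<n = proper (fromℕ< i<n) (fromℕ< j<n) (edge⇒adj (inj₁ e′))
                      (trans (cong col (toℕ-fromℕ< i<n)) (trans equal (sym (cong col (toℕ-fromℕ< j<n)))))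
    where
    e′ : E (toℕ (fromℕ< i<n)) (toℕ (fromℕ< j<n))
    e′ = subst₂ E (sym (toℕ-fromℕ< i<n)) (sym (toℕ-fromℕ< j<n)) e

  Completes : ∀ {j} → ℕ → (ℕ → Fin q) → (Fin j → Fin q) → Set
  Completes i g f = Proper G q (λ x → splice i g f (toℕ x))

  completes? : ∀ {j} i g → Decidable (Completes {j} i g)
  completes? i g f = proper? G q (λ x → splice i g f (toℕ x))

  ways : ℕ → ℕ → (ℕ → Fin q) → ℕ
  ways j i g = count (completes? {j} i g)

  ways-cons : ∀ j i g → ways (suc j) i g ≤ sum (λ c → ways j (suc i) (g [ i ≔ c ]))
  ways-cons j i g = ≤-trans (≤-reflexive (count-cons (completes? i g))) (sum-mono λ c →
    filter-length-mono (λ f → completes? i g (c ∷ᶠ f)) (completes? (suc i) (g [ i ≔ c ]))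
      (Proper-≗ G (λ x → splice-cons i g c _ (toℕ x))) (allColourings j q))

  ways-blocked : ∀ {x y} j i g → E x y → x < i → y < i → g x ≡ g y → ways j i g ≡ 0
  ways-blocked j i g e x<i y<i gx≡gy = count-none (completes? {j} i g) λ f →
    edge-conflict (splice i g f) e
      (trans (splice-below i g f x<i) (trans gx≡gy (sym (splice-below i g f y<i))))

  data Precedes : ℕ → ℕ → Set where
    first : Precedes a k
    next  : ∀ {p} → k ≤ p → Precedes p (suc p)

  precedes-edge : ∀ {p v} → Precedes p v → v < n → E p v
  precedes-edge first      _   = attachA
  precedes-edge (next k≤p) v<n = path k≤p v<n

  precedes-< : ∀ {p v} → Precedes p v → p < v
  precedes-< first    = a<k
  precedes-< (next _) = n<1+n _

  precedes-≥k : ∀ {p v} → Precedes p v → k ≤ v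
  precedes-≥k first      = ≤-refl
  precedes-≥k (next k≤p) = m≤n⇒m≤1+n k≤p

  precedes-last : ∀ {p v} → Precedes p v → v ≡ n → p ≡ n ∸ 1
  precedes-last first    k≡n = ⊥-elim (<-irrefl k≡n k<n)
  precedes-last (next _) v≡n = cong (_∸ 1) v≡n

  -- the bound for colouring the rest of the ear, in terms of the colour x of
  -- the previous ear vertex and the colour y of b
  weight : ℕ → Fin q → Fin q → ℕ
  weight j x y = if does (x ≟ y) then same q j else diff q j

  weight-distinct : ∀ j {x y} → x ≢ y → weight j x y ≡ diff q j
  weight-distinct j {x} {y} x≢y with x ≟ y
  ... | yes x≡y = ⊥-elim (x≢y x≡y)
  ... | no  _   = refl

  -- colouring the ear vertex by vertex: the completions of g from the ear vertex i,
  -- whose predecessor p is already coloured, are bounded by the weight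
  ear-bound : ∀ j i p g → i + j ≡ n → Precedes p i → ways j i g ≤ weight j (g p) (g b)
  ear-bound zero i p g i+0≡n prec with g p ≟ g b
  ... | yes gp≡gb = ≤-reflexive (ways-blocked 0 i g last (precedes-< prec) b<i gp≡gb)
    where
    i≡n : i ≡ n
    i≡n = trans (sym (+-identityʳ i)) i+0≡n
    last : E p b
    last = subst (λ v → E v b) (sym (precedes-last prec i≡n)) attachB
    b<i : b < i
    b<i = <-≤-trans b<k (precedes-≥k prec)
  ... | no  _     = count-empty (completes? i g)
  ear-bound (suc j) i p g i+j≡n prec = begin
    ways (suc j) i g                                              ≤⟨ ways-cons j i g ⟩
    sum (λ c → ways j (suc i) (g [ i ≔ c ]))                      ≤⟨ sum-mono bound ⟩
    sum (λ c → if does (c ≟ g p) then 0 else weight j c (g b))   ≡⟨ sum-avoiding (g p) (g b) _ _ ⟩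
    weight (suc j) (g p) (g b)                                    ∎
    where
    open ≤-Reasoning
    i<n : i < n
    i<n = subst (i <_) i+j≡n (m<m+n i (s≤s z≤n))
    b<i : b < i
    b<i = <-≤-trans b<k (precedes-≥k prec)
    bound : ∀ c → ways j (suc i) (g [ i ≔ c ]) ≤ (if does (c ≟ g p) then 0 else weight j c (g b))
    bound c with c ≟ g p
    ... | yes c≡gp = ≤-reflexive (ways-blocked j (suc i) (g [ i ≔ c ]) (precedes-edge prec i<n)
            (m≤n⇒m≤1+n (precedes-< prec)) (n<1+n i)
            (trans (set-below g i c (precedes-< prec)) (trans (sym c≡gp) (sym (set-at g i c)))))
    ... | no  _ = ≤-trans (ear-bound j (suc i) i (g [ i ≔ c ]) (trans (sym (+-suc i j)) i+j≡n)
                             (next (precedes-≥k prec)))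
                           (≤-reflexive (cong₂ (weight j) (set-at g i c) (set-below g i c b<i)))

  distinct-colours : ∀ {i} (g : ℕ → Fin q) → Unique (map g (downFrom i)) →
    ∀ {x y} → x < i → y < i → x ≢ y → g x ≢ g y
  distinct-colours {suc i} g (fresh ∷ uniq) {x} {y} x<i+1 y<i+1 x≢y
    with m<1+n⇒m<n∨m≡n x<i+1 | m<1+n⇒m<n∨m≡n y<i+1
  ... | inj₁ x<i | inj₁ y<i = distinct-colours g uniq x<i y<i x≢y
  ... | inj₂ refl | inj₁ y<i = All.lookup fresh (∈-map⁺ g (∈-downFrom⁺ y<i))
  ... | inj₁ x<i | inj₂ refl = All.lookup fresh (∈-map⁺ g (∈-downFrom⁺ x<i)) ∘ sym
  ... | inj₂ refl | inj₂ refl = ⊥-elim (x≢y refl)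

  -- colouring the clique vertex by vertex: vertex i avoids the colours of 0, …, i−1
  clique-bound : ∀ s i j (g : ℕ → Fin q) → i + s ≡ k → i + j ≡ n → Unique (map g (downFrom i)) →
    ways j i g ≤ falling (q ∸ i) s * diff q (n ∸ k)
  clique-bound zero i j g i+0≡k i+j≡n uniq = begin
    ways j i g                       ≤⟨ ear-bound j i a g i+j≡n (subst (Precedes a) (sym i≡k) first) ⟩
    weight j (g a) (g b)             ≡⟨ weight-distinct j (distinct-colours g uniq a<i b<i a≢b) ⟩
    diff q j                         ≡⟨ cong (diff q) j≡n∸k ⟩
    diff q (n ∸ k)                   ≡⟨ +-identityʳ _ ⟨
    1 * diff q (n ∸ k)               ∎
    where
    open ≤-Reasoning
    i≡k : i ≡ k
    i≡k = trans (sym (+-identityʳ i)) i+0≡k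
    j≡n∸k : j ≡ n ∸ k
    j≡n∸k = trans (sym (m+n∸m≡n i j)) (cong₂ _∸_ i+j≡n i≡k)
    a<i : a < i
    a<i = subst (a <_) (sym i≡k) a<k
    b<i : b < i
    b<i = subst (b <_) (sym i≡k) b<k
  clique-bound (suc s) i zero g i+s≡k i+0≡n uniq =
    ⊥-elim (<-asym k<n (subst₂ _<_ (trans (sym (+-identityʳ i)) i+0≡n) i+s≡k (m<m+n i (s≤s z≤n))))
  clique-bound (suc s) i (suc j) g i+s≡k i+j≡n uniq = begin
    ways (suc j) i g                                   ≤⟨ ways-cons j i g ⟩
    sum (λ c → ways j (suc i) (g [ i ≔ c ]))           ≤⟨ sum-mono bound ⟩
    sum (λ c → if does (c ∈? U) then 0 else F)         ≡⟨ sum-outside U F uniq ⟩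
    (q ∸ length U) * F                                 ≡⟨ cong (λ m → (q ∸ m) * F) length-U ⟩
    (q ∸ i) * (falling (q ∸ suc i) s * D)
      ≡⟨ cong (λ r → (q ∸ i) * (falling r s * D)) (pred[m∸n]≡m∸[1+n] q i) ⟨
    (q ∸ i) * (falling (pred (q ∸ i)) s * D)           ≡⟨ *-assoc (q ∸ i) _ D ⟨
    falling (q ∸ i) (suc s) * D                        ∎
    where
    open ≤-Reasoning
    D F : ℕ
    D = diff q (n ∸ k)
    F = falling (q ∸ suc i) s * D
    U : List (Fin q)
    U = map g (downFrom i)
    length-U : length U ≡ i
    length-U = trans (length-map g (downFrom i)) (length-downFrom i)
    i<k : i < k
    i<k = subst (i <_) i+s≡k (m<m+n i (s≤s z≤n))
    bound : ∀ c → ways j (suc i) (g [ i ≔ c ]) ≤ (if does (c ∈? U) then 0 else F)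
    bound c with c ∈? U
    ... | yes c∈U with ∈-map⁻ g c∈U
    ...   | y , y∈ , c≡gy = ≤-reflexive (ways-blocked j (suc i) (g [ i ≔ c ]) (clique y<i i<k)
              (m≤n⇒m≤1+n y<i) (n<1+n i)
              (trans (set-below g i c y<i) (trans (sym c≡gy) (sym (set-at g i c)))))
      where
      y<i : y < i
      y<i = ∈-downFrom⁻ y∈
    bound c | no c∉U = clique-bound s (suc i) j (g [ i ≔ c ])
      (trans (sym (+-suc i s)) i+s≡k) (trans (sym (+-suc i j)) i+j≡n) uniq′
      where
      unchanged : map (g [ i ≔ c ]) (downFrom i) ≡ U
      unchanged = map-cong-local (All.tabulate (λ x∈ → set-below g i c (∈-downFrom⁻ x∈)))
      uniq′ : Unique (map (g [ i ≔ c ]) (downFrom (suc i)))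
      uniq′ = subst Unique (sym (cong₂ _∷_ (set-at g i c) unchanged)) (¬Any⇒All¬ U c∉U ∷ uniq)

  -- the number of proper q-colourings of G_{n,k} is at most q (q−1) ⋯ (q−k+1) · diff q (n−k);
  -- the colour c₀ only serves as an arbitrary start of the partial colouring
  chromatic-bound : Fin q → P G q ≤ falling q k * diff q (n ∸ k)
  chromatic-bound c₀ = ≤-trans
    (filter-length-mono (proper? G q) (completes? 0 (λ _ → c₀))
      (Proper-≗ G (λ x → sym (prepend-toℕ _ _ x))) (allColourings n q))
    (clique-bound k 0 n (λ _ → c₀) refl refl [])

third : ℕ → ℕ → ℕ
third zero          zero          = 1
third zero          (suc zero)    = 2
third zero          (suc (suc _)) = 1
third (suc zero)    zero          = 2
third (suc zero)    (suc _)       = 0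
third (suc (suc _)) zero          = 1
third (suc (suc _)) (suc _)       = 0

third-≢ˡ : ∀ p q → third p q ≢ p
third-≢ˡ zero          zero          ()
third-≢ˡ zero          (suc zero)    ()
third-≢ˡ zero          (suc (suc _)) ()
third-≢ˡ (suc zero)    zero          ()
third-≢ˡ (suc zero)    (suc _)       ()
third-≢ˡ (suc (suc _)) zero          ()
third-≢ˡ (suc (suc _)) (suc _)       ()

third-≢ʳ : ∀ p q → third p q ≢ q
third-≢ʳ zero          zero          ()
third-≢ʳ zero          (suc zero)    ()
third-≢ʳ zero          (suc (suc _)) ()
third-≢ʳ (suc zero)    zero          ()
third-≢ʳ (suc zero)    (suc _)       ()
third-≢ʳ (suc (suc _)) zero          ()
third-≢ʳ (suc (suc _)) (suc _)       ()

third<3 : ∀ p q → third p q < 3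
third<3 zero          zero          = s≤s (s≤s z≤n)
third<3 zero          (suc zero)    = s≤s (s≤s (s≤s z≤n))
third<3 zero          (suc (suc _)) = s≤s (s≤s z≤n)
third<3 (suc zero)    zero          = s≤s (s≤s (s≤s z≤n))
third<3 (suc zero)    (suc _)       = s≤s z≤n
third<3 (suc (suc _)) zero          = s≤s (s≤s z≤n)
third<3 (suc (suc _)) (suc _)       = s≤s z≤n

-- Greedy colouring of a path x = σ 0, σ 1, σ 2, … that is followed by a vertex of
-- colour y: pinned positions get colour d, every other position the least colour
-- avoiding its predecessor and the colour its successor is forced to avoid.
module EarSequence (x y d : ℕ) {Pinned : ℕ → Set} (pinned? : Decidable Pinned) where

  -- the colour the successor of position j forces position j to avoid
  ahead : ℕ → ℕ
  ahead j = if does (pinned? (suc j)) then d else y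

  σ : ℕ → ℕ
  σ zero    = x
  σ (suc j) = if does (pinned? (suc j)) then d else third (σ j) (ahead (suc j))

  σ-pinned : ∀ j → Pinned (suc j) → σ (suc j) ≡ d
  σ-pinned j p with pinned? (suc j)
  ... | yes _ = refl
  ... | no ¬p = ⊥-elim (¬p p)

  σ-bounded : ∀ {K} → x < K → d < K → 3 ≤ K → ∀ j → σ j < K
  σ-bounded x<K d<K 3≤K zero = x<K
  σ-bounded x<K d<K 3≤K (suc j) with pinned? (suc j)
  ... | yes _ = d<K
  ... | no  _ = <-≤-trans (third<3 (σ j) _) 3≤K

  σ-end : ∀ j → (Pinned (suc j) → d ≢ y) → ¬ Pinned (suc (suc j)) → σ (suc j) ≢ y
  σ-end j last-ok next-free with pinned? (suc j)
  ... | yes p = last-ok p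
  ... | no  _ with pinned? (suc (suc j))
  ...   | yes p = ⊥-elim (next-free p)
  ...   | no  _ = third-≢ʳ (σ j) y

  σ-adjacent : (Pinned 1 → d ≢ x) → (∀ j → Pinned j → ¬ Pinned (suc j)) → ∀ j → σ j ≢ σ (suc j)
  σ-adjacent first-ok isolated zero with pinned? 1
  ... | yes p = λ x≡d → first-ok p (sym x≡d)
  ... | no  _ = λ x≡third → third-≢ˡ x _ (sym x≡third)
  σ-adjacent first-ok isolated (suc j) with pinned? (suc (suc j))
  ... | no  _ = λ s≡third → third-≢ˡ _ _ (sym s≡third)
  ... | yes p with pinned? (suc j)
  ...   | yes p′ = ⊥-elim (isolated (suc j) p′ p)
  ...   | no  _  = third-≢ʳ (σ j) d

≢-by : ∀ {x x′ y y′ : ℕ} → x ≡ x′ → y ≡ y′ → x′ ≢ y′ → x ≢ y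
≢-by refl refl x′≢y′ = x′≢y′

-- A proper k-colouring of G_{n,k} (k ≥ 3) identifying two given non-adjacent vertices.
module EarWitness {n k a b : ℕ} (3≤k : 3 ≤ k) (a<k : a < k) (b<k : b < k) (k<n : k < n) where

  E : ℕ → ℕ → Set
  E = EarEdge n k a b

  -- the ear is a = w 0, w 1 = k, w 2 = k+1, …, w r = n−1, followed by b;
  -- the ear vertex v ≥ k is w (pos v)
  r : ℕ
  r = n ∸ k

  pos : ℕ → ℕ
  pos v = suc (v ∸ k)

  k≤n∸1 : k ≤ n ∸ 1
  k≤n∸1 = ∸-monoˡ-≤ 1 k<n

  pos-first : pos k ≡ 1
  pos-first = cong suc (n∸n≡0 k)

  pos-suc : ∀ {v} → k ≤ v → pos (suc v) ≡ suc (pos v)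
  pos-suc k≤v = cong suc (+-∸-assoc 1 k≤v)

  pos-last : pos (n ∸ 1) ≡ r
  pos-last = trans (sym (+-∸-assoc 1 k≤n∸1)) (cong (_∸ k) (m+[n∸m]≡n (≤-trans (s≤s z≤n) k<n)))

  pos-≤ : ∀ {v} → k ≤ v → v < n → pos v ≤ r
  pos-≤ k≤v v<n = ∸-monoˡ-< v<n k≤v

  pos-injective : ∀ {u v} → k ≤ u → k ≤ v → pos u ≡ pos v → u ≡ v
  pos-injective k≤u k≤v eq = ∸-cancelʳ-≡ k≤u k≤v (suc-injective eq)

  record Identifying (U V : ℕ) : Set where
    field
      col        : ℕ → ℕ
      separating : ∀ {i j} → E i j → col i ≢ col j
      bounded    : ∀ v → col v < k
      identifies : col U ≡ col V

  -- clique vertex v gets colour v, ear vertex v the colour of position pos v of the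
  -- greedy ear sequence starting with colour a and followed by colour b
  module Colouring (d : ℕ) (d<k : d < k) {Pinned : ℕ → Set} (pinned? : Decidable Pinned)
      (first-ok : Pinned 1 → d ≢ a)
      (last-ok  : Pinned r → d ≢ b)
      (isolated : ∀ j → Pinned j → ¬ Pinned (suc j))
      (within   : ¬ Pinned (suc r)) where

    open EarSequence a b d pinned? public

    colour : ℕ → ℕ
    colour v with v <? k
    ... | yes _ = v
    ... | no  _ = σ (pos v)

    colour-clique : ∀ {v} → v < k → colour v ≡ v
    colour-clique {v} v<k with v <? k
    ... | yes _   = refl
    ... | no  v≮k = ⊥-elim (v≮k v<k)

    colour-ear : ∀ {v} → k ≤ v → colour v ≡ σ (pos v)
    colour-ear {v} k≤v with v <? k
    ... | yes v<k = ⊥-elim (<⇒≱ v<k k≤v)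
    ... | no  _   = refl

    -- the colouring is proper: clique colours are distinct, ear colours follow σ-adjacent,
    -- and the two attaching edges are handled by the first and last positions of σ
    separating : ∀ {i j} → E i j → colour i ≢ colour j
    separating (clique i<j j<k) =
      ≢-by (colour-clique (<-trans i<j j<k)) (colour-clique j<k) (<⇒≢ i<j)
    separating (path {i} k≤i _) =
      ≢-by (colour-ear k≤i) (trans (colour-ear (m≤n⇒m≤1+n k≤i)) (cong σ (pos-suc k≤i)))
        (σ-adjacent first-ok isolated (pos i))
    separating attachA =
      ≢-by (colour-clique a<k) (trans (colour-ear (≤-refl {k})) (cong σ pos-first))
        (σ-adjacent first-ok isolated 0)
    separating attachB =
      ≢-by (colour-ear k≤n∸1) (colour-clique b<k)
        (σ-end (n ∸ 1 ∸ k) (subst (λ m → Pinned m → d ≢ b) (sym pos-last) last-ok)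
                           (subst (λ m → ¬ Pinned (suc m)) (sym pos-last) within))

    bounded : ∀ v → colour v < k
    bounded v with v <? k
    ... | yes v<k = v<k
    ... | no  _   = σ-bounded a<k d<k 3≤k (pos v)

  -- U in the clique, V on the ear: pin the position of V to the colour U
  identify-clique-ear : ∀ {U V} → U < k → k ≤ V → V < n → ¬ E U V → ¬ E V U → Identifying U V
  identify-clique-ear {U} {V} U<k k≤V V<n ¬UV ¬VU = record
    { col        = colour
    ; separating = separating
    ; bounded    = bounded
    ; identifies = trans (colour-clique U<k) (sym (trans (colour-ear k≤V) (σ-pinned (V ∸ k) refl)))
    }
    where
    first-ok : 1 ≡ pos V → U ≢ a
    first-ok 1≡posV refl = ¬UV (subst (E U) (pos-injective ≤-refl k≤V (trans pos-first 1≡posV)) attachA)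
    last-ok : r ≡ pos V → U ≢ b
    last-ok r≡posV refl = ¬VU (subst (λ v → E v U) (pos-injective k≤n∸1 k≤V (trans pos-last r≡posV)) attachB)
    isolated : ∀ j → j ≡ pos V → ¬ suc j ≡ pos V
    isolated j refl = 1+n≢n
    within : ¬ suc r ≡ pos V
    within r+1≡posV = 1+n≰n (subst (_≤ r) (sym r+1≡posV) (pos-≤ k≤V V<n))
    open Colouring U U<k (λ j → j ≟ℕ pos V) first-ok last-ok isolated within

  -- U and V both on the ear: pin both positions to a colour other than those of a and b
  identify-ear-ear : ∀ {U V} → k ≤ U → U < V → V < n → ¬ E U V → Identifying U V
  identify-ear-ear {U} {V} k≤U U<V V<n ¬UV = record
    { col        = colour
    ; separating = separating
    ; bounded    = bounded
    ; identifies = trans (colour-ear k≤U) (trans (σ-pinned (U ∸ k) (inj₁ refl))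
                     (sym (trans (colour-ear k≤V) (σ-pinned (V ∸ k) (inj₂ refl)))))
    }
    where
    k≤V : k ≤ V
    k≤V = ≤-trans k≤U (<⇒≤ U<V)
    Pinned : ℕ → Set
    Pinned j = j ≡ pos U ⊎ j ≡ pos V
    isolated : ∀ j → Pinned j → ¬ Pinned (suc j)
    isolated j (inj₁ refl) (inj₁ eq) = 1+n≢n eq
    isolated j (inj₁ refl) (inj₂ eq) = ¬UV (subst (E U) (sym V≡U+1) (path k≤U (subst (_< n) V≡U+1 V<n)))
      where
      V≡U+1 : V ≡ suc U
      V≡U+1 = pos-injective k≤V (m≤n⇒m≤1+n k≤U) (trans (sym eq) (sym (pos-suc k≤U)))
    isolated j (inj₂ refl) (inj₁ eq) = <-asym (s≤s (∸-monoˡ-< U<V k≤U)) (subst (pos V <_) eq ≤-refl)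
    isolated j (inj₂ refl) (inj₂ eq) = 1+n≢n eq
    within : ¬ Pinned (suc r)
    within (inj₁ eq) = 1+n≰n (subst (_≤ r) (sym eq) (pos-≤ k≤U (<-trans U<V V<n)))
    within (inj₂ eq) = 1+n≰n (subst (_≤ r) (sym eq) (pos-≤ k≤V V<n))
    open Colouring (third a b) (<-≤-trans (third<3 a b) 3≤k) (λ j → (j ≟ℕ pos U) ⊎-dec (j ≟ℕ pos V))
      (λ _ → third-≢ˡ a b) (λ _ → third-≢ʳ a b) isolated within

  identify : ∀ {U V} → U < V → V < n → ¬ E U V → ¬ E V U → Identifying U V
  identify {U} {V} U<V V<n ¬UV ¬VU with V <? k | U <? k
  ... | yes V<k | _       = ⊥-elim (¬UV (clique U<V V<k))
  ... | no  V≮k | yes U<k = identify-clique-ear U<k (≮⇒≥ V≮k) V<n ¬UV ¬VU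
  ... | no  V≮k | no  U≮k = identify-ear-ear (≮⇒≥ U≮k) U<V V<n ¬UV

  identifying-sym : ∀ {U V} → Identifying U V → Identifying V U
  identifying-sym w = record
    { col = col ; separating = separating ; bounded = bounded ; identifies = sym identifies }
    where open Identifying w

  realise : ∀ (u v : Fin n) → Identifying (toℕ u) (toℕ v) →
    Σ[ c ∈ (Fin n → Fin k) ] Proper (Gnk n k a b) k c × c u ≡ c v
  realise u v w =
    let (c , proper , toℕ-c) = proper-from-ℕ col bounded separating
    in  c , proper , toℕ-injective (trans (toℕ-c u) (trans identifies (sym (toℕ-c v))))
    where open Identifying w

  identifying-colouring : (u v : Fin n) → u ≢ v → Gnk n k a b u v ≡ false →
    Σ[ c ∈ (Fin n → Fin k) ] Proper (Gnk n k a b) k c × c u ≡ c v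
  identifying-colouring u v u≢v nonadj with <-cmp (toℕ u) (toℕ v)
  ... | tri< u<v _ _ =
    realise u v (identify u<v (toℕ<n v) (non-adjacent nonadj ∘ inj₁) (non-adjacent nonadj ∘ inj₂))
  ... | tri> _ _ v<u =
    realise u v (identifying-sym
      (identify v<u (toℕ<n u) (non-adjacent nonadj ∘ inj₂) (non-adjacent nonadj ∘ inj₁)))
  ... | tri≈ _ u≡v _ = ⊥-elim (u≢v (toℕ-injective u≡v))

pos-^ : ∀ t e → (+ t) ^ℤ e ≡ + (t ^ e)
pos-^ t zero    = refl
pos-^ t (suc e) = trans (cong (+ t *ℤ_) (pos-^ t e)) (sym (pos-* t (t ^ e)))

closed-form : ∀ t′ m → let t = suc t′ ; k = suc t in
  + (t !) *ℤ ((+ t) ^ℤ (m + 1) +ℤ -1ℤ ^ℤ m) ≡ + (k ! * diff k m)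
closed-form t′ m = begin
  + (t !) *ℤ ((+ t) ^ℤ (m + 1) +ℤ -1ℤ ^ℤ m)
    ≡⟨ cong (λ e → + (t !) *ℤ ((+ t) ^ℤ e +ℤ -1ℤ ^ℤ m)) (+-comm m 1) ⟩
  + (t !) *ℤ ((+ t) ^ℤ suc m +ℤ -1ℤ ^ℤ m)
    ≡⟨ cong (λ z → + (t !) *ℤ (z +ℤ -1ℤ ^ℤ m)) (pos-^ t (suc m)) ⟩
  + (t !) *ℤ (+ (t ^ suc m) +ℤ -1ℤ ^ℤ m)      ≡⟨ cong (+ (t !) *ℤ_) (diff-closed t′ m) ⟨
  + (t !) *ℤ + (k * diff k m)                 ≡⟨ pos-* (t !) (k * diff k m) ⟨
  + (t ! * (k * diff k m))                    ≡⟨ cong +_ (*-assoc (t !) k (diff k m)) ⟨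
  + (t ! * k * diff k m)                      ≡⟨ cong (λ x → + (x * diff k m)) (*-comm (t !) k) ⟩
  + (k ! * diff k m)                          ∎
  where
  open ≡-Reasoning
  t k : ℕ
  t = suc t′
  k = suc t

lemma8 : (n k a b : ℕ) → 3 ≤ k → k < n → a < k → b < k → a ≢ b →
    (u v : Fin n) → u ≢ v → Gnk n k a b u v ≡ false →
    + P (Gnk n k a b +E u ─ v) k
    <ℤ (+ ((k ∸ 1) !)) *ℤ ((+ (k ∸ 1)) ^ℤ (n ∸ k + 1) +ℤ (-1ℤ ^ℤ (n ∸ k)))
lemma8 n k@(suc (suc t′)) a b 3≤k@(s≤s (s≤s _)) k<n a<k b<k a≢b u v u≢v nonadj =
  subst (+ P (G +E u ─ v) k <ℤ_) (sym (closed-form t′ (n ∸ k))) (+<+ (<-≤-trans fewer bound))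
  where
  G : Graph n
  G = Gnk n k a b
  fewer : P (G +E u ─ v) k < P G k
  fewer = let (c , proper , cu≡cv) = EarWitness.identifying-colouring 3≤k a<k b<k k<n u v u≢v nonadj
          in P-+E-< G u v c proper cu≡cv
  bound : P G k ≤ k ! * diff k (n ∸ k)
  bound = subst (λ f → P G k ≤ f * diff k (n ∸ k)) (falling-! k)
                (EarCount.chromatic-bound a<k b<k k<n a≢b k zero)
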